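{- Let $n\ge2$ and let $c$ be a conjugacy class of $\mathrm{Sym}(n)$ consisting of odd permutations. If $S$ is an independent set in the Cayley graph $\Gamma(\mathrm{Sym}(n);c)$, then $|S|\le n!/2$, and equality holds if and only if $S$ is either $\mathrm{Alt}(n)$ or $(1\,2)\mathrm{Alt}(n)$.
   Context: For a group $G$ and a subset $S\subseteq G$ closed under inversion and not containing the identity, the Cayley graph $\Gamma(G;S)$ has vertex set $G$, with $g$ and $h$ adjacent iff $gh^{ -1}\in S$. An independent set is a set of pairwise non-adjacent vertices. -}

module Defs where

open import Data.Nat using (ℕ; zero; suc; _≤_; _<_; s≤s; z≤n; _%_)
open import Data.Fin using (Fin; fromℕ<) renaming (_<_ to _<ᶠ_; _<?_ to _<ᶠ?_)
open import Data.Fin.Permutation using (Permutation′; _⟨$⟩ʳ_; _∘ₚ_; flip; transpose; _≈_)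
open import Data.List using (List; length; filter; cartesianProduct; allFin)
open import Data.List.Relation.Unary.Any using (Any)
open import Data.List.Relation.Unary.AllPairs using (AllPairs)
open import Data.Product using (Σ; _×_; _,_; ∃; proj₁; proj₂)
open import Relation.Nullary using (¬_)
open import Relation.Nullary.Decidable using (_×-dec_)
open import Relation.Binary.PropositionalEquality using (_≡_)

-- Group product in Sym(n), as functions: (g · h)(i) = g(h(i)).
infixl 7 _·_
_·_ : ∀ {n} → Permutation′ n → Permutation′ n → Permutation′ n
g · h = h ∘ₚ g

_⁻¹ : ∀ {n} → Permutation′ n → Permutation′ n
g ⁻¹ = flip g

inversions : ∀ {n} → Permutation′ n → ℕ
inversions {n} π =
  length (filter (λ ij → (proj₁ ij <ᶠ? proj₂ ij) ×-dec ((π ⟨$⟩ʳ proj₂ ij) <ᶠ? (π ⟨$⟩ʳ proj₁ ij)))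
                 (cartesianProduct (allFin n) (allFin n)))

IsEven IsOdd : ∀ {n} → Permutation′ n → Set
IsEven π = inversions π % 2 ≡ 0
IsOdd  π = inversions π % 2 ≡ 1

InClass : ∀ {n} → Permutation′ n → Permutation′ n → Set
InClass g h = ∃ λ σ → h ≈ σ · g · σ ⁻¹

Adjacent : ∀ {n} → Permutation′ n → Permutation′ n → Permutation′ n → Set
Adjacent g x y = InClass g (x · y ⁻¹)

-- a finite subset of Sym(n): a duplicate-free list (distinct up to pointwise equality)
Distinct : ∀ {n} → List (Permutation′ n) → Set
Distinct S = AllPairs (λ a b → ¬ (a ≈ b)) S

_∈ₚ_ : ∀ {n} → Permutation′ n → List (Permutation′ n) → Set
p ∈ₚ S = Any (λ q → p ≈ q) S

Independent : ∀ {n} → Permutation′ n → List (Permutation′ n) → Set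
Independent g S = ∀ x y → x ∈ₚ S → y ∈ₚ S → ¬ Adjacent g x y

t12 : ∀ {n} → 2 ≤ n → Permutation′ n
t12 (s≤s (s≤s _)) = transpose Fin.zero (Fin.suc Fin.zero)

IsAlt : ∀ {n} → List (Permutation′ n) → Set
IsAlt S = ∀ p → (p ∈ₚ S → IsEven p) × (IsEven p → p ∈ₚ S)

IsT12Alt : ∀ {n} → 2 ≤ n → List (Permutation′ n) → Set
IsT12Alt h S = ∀ p → (p ∈ₚ S → InCoset p) × (InCoset p → p ∈ₚ S)
  where InCoset : _ → Set
        InCoset p = ∃ λ a → IsEven a × (p ≈ t12 h · a)

-- Independence says that x and c x are never both in S for c in the class C of g, so S and c⁻¹S are
-- disjoint and |S| ≤ n!/2.  At equality they cover Sym(n), so left multiplication by any element of C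
-- exchanges S with its complement, and products of two elements of C preserve S.  Such products include
-- (u v) g (u v) g⁻¹ = (u v)(g u  g v), a 3-cycle for suitable u, v (when g is a fixed-point-free
-- involution, after first replacing g by g h h′ with h, h′ of this form); by 3-transitivity every
-- 3-cycle, in particular (k k+1)(k+1 k+2), then preserves S.  Hence every adjacent transposition acts on
-- membership like t = (1 2), and sorting y by adjacent swaps gives y x ∈ S ⇔ t^(inv y) x ∈ S.  As g is
-- odd, t also exchanges S with its complement, so S is Alt(n) or t Alt(n); conversely both have n!/2
-- elements since t exchanges them.

module Submission where

open import Defs
open import Level using (0ℓ)
open import Data.Nat using (ℕ; zero; suc; _≤_; _<_; s≤s; z≤n; _!; _+_; _*_; _∸_; _%_)
import Data.Nat.Properties as ℕₚ
open import Data.Nat.DivMod using (_/_; m*[n/m]≡n)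
open import Data.Nat.Divisibility using (m≤n⇒m!∣n!)
open import Data.Fin using (Fin; zero; suc; toℕ; inject₁; fromℕ; punchIn)
  renaming (_<_ to _<ᶠ_; _<?_ to _<ᶠ?_)
import Data.Fin.Properties as Finₚ
open import Data.Fin.Induction using (<-weakInduction; >-weakInduction)
open import Data.Fin.Permutation
  using (Permutation′; _⟨$⟩ʳ_; _⟨$⟩ˡ_; _≈_; flip; transpose; insert; remove; inverseˡ; inverseʳ; insert-remove)
  renaming (id to idₚ)
import Data.Fin.Permutation.Components as PC
open import Data.List as List using (List; []; _∷_; length; map; _++_; allFin; filter; cartesianProduct)
import Data.List.Properties as Listₚ
open import Data.List.Relation.Unary.Any as Any using (here; there; any?)
import Data.List.Relation.Unary.Any.Properties as Anyₚ
open import Data.List.Relation.Unary.All as All using (All; []; _∷_)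
import Data.List.Relation.Unary.All.Properties as Allₚ
open import Data.List.Relation.Unary.AllPairs as AllPairs using ([]; _∷_)
import Data.List.Relation.Unary.AllPairs.Properties as AllPairsₚ
open import Data.List.Membership.Propositional using (_∈_)
open import Data.List.Membership.Propositional.Properties using (∈-allFin; ∈-cartesianProduct⁺)
open import Data.List.Relation.Unary.Unique.Propositional using (Unique)
open import Data.List.Relation.Unary.Unique.Propositional.Properties using (allFin⁺; cartesianProduct⁺)
import Data.List.Membership.Setoid as SetoidMembership
import Data.List.Membership.Setoid.Properties as SetoidMembershipₚ
import Data.List.Relation.Unary.Unique.Setoid as SetoidUnique
import Data.List.Relation.Unary.Unique.Setoid.Properties as SetoidUniqueₚ
open import Data.Product using (_×_; _,_; ∃; proj₁; proj₂)
open import Data.Sum as Sum using (_⊎_; inj₁; inj₂; [_,_]′)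
open import Data.Empty using (⊥-elim)
open import Function using (_∘_)
open import Function.Bundles using (_⇔_; mk⇔; Equivalence)
open import Function.Construct.Symmetry using (⇔-sym)
open import Function.Construct.Composition using (_⇔-∘_)
open import Function.Properties.Equivalence using (⇔-setoid)
open import Function.Construct.Identity using (⇔-id)
open import Function.Related.TypeIsomorphisms using (¬-cong-⇔)
open import Relation.Unary using (Pred; Decidable)
open import Relation.Nullary using (¬_; ¬?; Dec; yes; no)
open import Relation.Nullary.Decidable using (dec-true; dec-false; _×-dec_; decidable-stable)
open import Relation.Binary.Bundles using (Setoid)
import Relation.Binary.Reasoning.Setoid as SetoidReasoning
open import Relation.Binary.PropositionalEquality

Perm : ℕ → Set
Perm = Permutation′

≈-setoid : ℕ → Setoid 0ℓ 0ℓ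
≈-setoid n = record
  { Carrier       = Perm n
  ; _≈_           = _≈_
  ; isEquivalence = record
    { refl  = λ _ → refl
    ; sym   = λ p i → sym (p i)
    ; trans = λ p q i → trans (p i) (q i)
    }
  }

module _ {n : ℕ} where

  ⟨$⟩ʳ-injective : (a : Perm n) {i j : Fin n} → a ⟨$⟩ʳ i ≡ a ⟨$⟩ʳ j → i ≡ j
  ⟨$⟩ʳ-injective a {i} {j} eq = begin
    i                    ≡⟨ inverseˡ a ⟨
    a ⟨$⟩ˡ (a ⟨$⟩ʳ i)   ≡⟨ cong (a ⟨$⟩ˡ_) eq ⟩
    a ⟨$⟩ˡ (a ⟨$⟩ʳ j)   ≡⟨ inverseˡ a ⟩
    j                    ∎
    where open ≡-Reasoning

  _≈?_ : (a b : Perm n) → Dec (a ≈ b)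
  a ≈? b = Finₚ.all? (λ i → a ⟨$⟩ʳ i Finₚ.≟ b ⟨$⟩ʳ i)

  _∈ₚ?_ : (p : Perm n) (S : List (Perm n)) → Dec (p ∈ₚ S)
  p ∈ₚ? S = any? (p ≈?_) S

  ∈ₚ-resp-≈ : {p q : Perm n} {S : List (Perm n)} → p ≈ q → p ∈ₚ S → q ∈ₚ S
  ∈ₚ-resp-≈ p≈q = Any.map (λ p≈r i → trans (sym (p≈q i)) (p≈r i))

  conj : Perm n → Perm n → Perm n
  conj σ e = σ · e · σ ⁻¹

  conj-· : (σ a b : Perm n) → conj σ a · conj σ b ≈ conj σ (a · b)
  conj-· σ a b i = cong (λ j → σ ⟨$⟩ʳ (a ⟨$⟩ʳ j)) (inverseˡ σ)

  conj-·-right : (σ e x : Perm n) → conj σ e · (σ · x) ≈ σ · e · x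
  conj-·-right σ e x i = cong (λ j → σ ⟨$⟩ʳ (e ⟨$⟩ʳ j)) (inverseˡ σ)

module _ {n : ℕ} where

  transpose-matchˡ : (i j : Fin n) → PC.transpose i j i ≡ j
  transpose-matchˡ i j rewrite dec-true (i Finₚ.≟ i) refl = refl

  transpose-matchʳ : (i j : Fin n) → PC.transpose i j j ≡ i
  transpose-matchʳ i j with j Finₚ.≟ i
  ... | yes refl = refl
  ... | no _ rewrite dec-true (j Finₚ.≟ j) refl = refl

  transpose-other : {i j k : Fin n} → k ≢ i → k ≢ j → PC.transpose i j k ≡ k
  transpose-other {i} {j} {k} k≢i k≢j rewrite dec-false (k Finₚ.≟ i) k≢i | dec-false (k Finₚ.≟ j) k≢j = refl

  transpose-comm : (i j k : Fin n) → PC.transpose i j k ≡ PC.transpose j i k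
  transpose-comm i j k = cases (k Finₚ.≟ i) (k Finₚ.≟ j)
    where
    cases : Dec (k ≡ i) → Dec (k ≡ j) → PC.transpose i j k ≡ PC.transpose j i k
    cases (yes k≡i) _ rewrite k≡i = trans (transpose-matchˡ i j) (sym (transpose-matchʳ j i))
    cases (no _) (yes k≡j) rewrite k≡j = trans (transpose-matchʳ i j) (sym (transpose-matchˡ j i))
    cases (no k≢i) (no k≢j) = trans (transpose-other k≢i k≢j) (sym (transpose-other k≢j k≢i))

  transpose-involutive : (i j k : Fin n) → PC.transpose i j (PC.transpose i j k) ≡ k
  transpose-involutive i j k = trans (cong (PC.transpose i j) (transpose-comm i j k)) (PC.transpose-inverse i j)

  transpose-natural : (σ : Perm n) (i j k : Fin n) →
                      σ ⟨$⟩ʳ PC.transpose i j k ≡ PC.transpose (σ ⟨$⟩ʳ i) (σ ⟨$⟩ʳ j) (σ ⟨$⟩ʳ k)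
  transpose-natural σ i j k = cases (k Finₚ.≟ i) (k Finₚ.≟ j)
    where
    cases : Dec (k ≡ i) → Dec (k ≡ j) →
            σ ⟨$⟩ʳ PC.transpose i j k ≡ PC.transpose (σ ⟨$⟩ʳ i) (σ ⟨$⟩ʳ j) (σ ⟨$⟩ʳ k)
    cases (yes k≡i) _ rewrite k≡i =
      trans (cong (σ ⟨$⟩ʳ_) (transpose-matchˡ i j)) (sym (transpose-matchˡ (σ ⟨$⟩ʳ i) (σ ⟨$⟩ʳ j)))
    cases (no _) (yes k≡j) rewrite k≡j =
      trans (cong (σ ⟨$⟩ʳ_) (transpose-matchʳ i j)) (sym (transpose-matchʳ (σ ⟨$⟩ʳ i) (σ ⟨$⟩ʳ j)))
    cases (no k≢i) (no k≢j) = trans (cong (σ ⟨$⟩ʳ_) (transpose-other k≢i k≢j))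
      (sym (transpose-other (k≢i ∘ ⟨$⟩ʳ-injective σ) (k≢j ∘ ⟨$⟩ʳ-injective σ)))

  transpose-·-involutive : (i j : Fin n) → transpose i j · transpose i j ≈ idₚ
  transpose-·-involutive i j k = transpose-involutive i j k

  conj-transpose : (σ : Perm n) (i j : Fin n) → conj σ (transpose i j) ≈ transpose (σ ⟨$⟩ʳ i) (σ ⟨$⟩ʳ j)
  conj-transpose σ i j k = trans (transpose-natural σ i j (σ ⟨$⟩ˡ k)) (cong (PC.transpose _ _) (inverseʳ σ))

module _ {n : ℕ} where

  threeCycle : Fin n → Fin n → Fin n → Perm n
  threeCycle a b c = transpose a b · transpose b c

  conj-threeCycle : (σ : Perm n) (a b c : Fin n) →
                    conj σ (threeCycle a b c) ≈ threeCycle (σ ⟨$⟩ʳ a) (σ ⟨$⟩ʳ b) (σ ⟨$⟩ʳ c)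
  conj-threeCycle σ a b c i = begin
    conj σ (transpose a b · transpose b c) ⟨$⟩ʳ i
      ≡⟨ conj-· σ (transpose a b) (transpose b c) i ⟨
    conj σ (transpose a b) ⟨$⟩ʳ (conj σ (transpose b c) ⟨$⟩ʳ i)
      ≡⟨ conj-transpose σ a b _ ⟩
    PC.transpose (σ ⟨$⟩ʳ a) (σ ⟨$⟩ʳ b) (conj σ (transpose b c) ⟨$⟩ʳ i)
      ≡⟨ cong (PC.transpose _ _) (conj-transpose σ b c i) ⟩
    threeCycle (σ ⟨$⟩ʳ a) (σ ⟨$⟩ʳ b) (σ ⟨$⟩ʳ c) ⟨$⟩ʳ i ∎
    where open ≡-Reasoning

Distinct₃ : {n : ℕ} → Fin n → Fin n → Fin n → Set
Distinct₃ a b c = a ≢ b × a ≢ c × b ≢ c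

avoid-two : {n : ℕ} {a b c : Fin n} → Distinct₃ a b c → ∀ x → ∃ λ d → d ≢ a × d ≢ x
avoid-two {b = b} {c} (a≢b , a≢c , b≢c) x with b Finₚ.≟ x
... | yes b≡x = c , a≢c ∘ sym , b≢c ∘ trans b≡x ∘ sym
... | no b≢x  = b , a≢b ∘ sym , b≢x

3-transitive : {n : ℕ} {a b c a′ b′ c′ : Fin n} → Distinct₃ a b c → Distinct₃ a′ b′ c′ →
               ∃ λ (π : Perm n) → π ⟨$⟩ʳ a ≡ a′ × π ⟨$⟩ʳ b ≡ b′ × π ⟨$⟩ʳ c ≡ c′
3-transitive {a = a} {b} {c} {a′} {b′} {c′} (a≢b , a≢c , b≢c) (a′≢b′ , a′≢c′ , b′≢c′) =
  π₃ · π₂ · π₁ , a↦a′ , b↦b′ , c↦c′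
  where
  π₁ = transpose a a′
  π₂ = transpose (π₁ ⟨$⟩ʳ b) b′
  π₃ = transpose (π₂ ⟨$⟩ʳ (π₁ ⟨$⟩ʳ c)) c′
  a′≢π₁b : a′ ≢ π₁ ⟨$⟩ʳ b
  a′≢π₁b eq = a≢b (⟨$⟩ʳ-injective π₁ (trans (transpose-matchˡ a a′) eq))
  π₂a′≡a′ : π₂ ⟨$⟩ʳ a′ ≡ a′
  π₂a′≡a′ = transpose-other a′≢π₁b a′≢b′
  a′≢π₂π₁c : a′ ≢ π₂ ⟨$⟩ʳ (π₁ ⟨$⟩ʳ c)
  a′≢π₂π₁c eq = a≢c (⟨$⟩ʳ-injective π₁ (trans (transpose-matchˡ a a′)
                       (⟨$⟩ʳ-injective π₂ (trans π₂a′≡a′ eq))))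
  b′≢π₂π₁c : b′ ≢ π₂ ⟨$⟩ʳ (π₁ ⟨$⟩ʳ c)
  b′≢π₂π₁c eq = b≢c (⟨$⟩ʳ-injective π₁ (⟨$⟩ʳ-injective π₂ (trans (transpose-matchˡ (π₁ ⟨$⟩ʳ b) b′) eq)))
  a↦a′ : (π₃ · π₂ · π₁) ⟨$⟩ʳ a ≡ a′
  a↦a′ rewrite transpose-matchˡ a a′ | π₂a′≡a′ = transpose-other a′≢π₂π₁c a′≢c′
  b↦b′ : (π₃ · π₂ · π₁) ⟨$⟩ʳ b ≡ b′
  b↦b′ rewrite transpose-matchˡ (π₁ ⟨$⟩ʳ b) b′ = transpose-other b′≢π₂π₁c b′≢c′
  c↦c′ : (π₃ · π₂ · π₁) ⟨$⟩ʳ c ≡ c′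
  c↦c′ = transpose-matchˡ (π₂ ⟨$⟩ʳ (π₁ ⟨$⟩ʳ c)) c′

-- Counting permutations

module _ {c ℓ} (A : Setoid c ℓ) where
  open Setoid A using () renaming (_≈_ to _≈ₛ_; sym to ≈ₛ-sym; trans to ≈ₛ-trans)
  open SetoidMembership A using (_─_) renaming (_∈_ to _∈ₛ_)
  open SetoidUnique A using () renaming (Unique to Uniqueₛ)

  ∈-─ : ∀ {x y} ys (x∈ys : x ∈ₛ ys) → y ∈ₛ ys → ¬ y ≈ₛ x → y ∈ₛ (ys ─ x∈ys)
  ∈-─ (z ∷ ys) (here x≈z) (here y≈z) y≉x = ⊥-elim (y≉x (≈ₛ-trans y≈z (≈ₛ-sym x≈z)))
  ∈-─ (z ∷ ys) (here _)   (there y∈ys) _  = y∈ys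
  ∈-─ (z ∷ ys) (there _)  (here y≈z)   _  = here y≈z
  ∈-─ (z ∷ ys) (there x∈ys) (there y∈ys) y≉x = there (∈-─ ys x∈ys y∈ys y≉x)

  Unique-⊆⇒length≤ : ∀ {xs ys} → Uniqueₛ xs → All (_∈ₛ ys) xs → length xs ≤ length ys
  Unique-⊆⇒length≤ {[]}     _               _                 = z≤n
  Unique-⊆⇒length≤ {x ∷ xs} {ys} (x≉xs ∷ xs!) (x∈ys ∷ xs⊆ys) = begin
    suc (length xs)          ≤⟨ s≤s (Unique-⊆⇒length≤ xs! xs⊆ys─x) ⟩
    suc (length (ys ─ x∈ys)) ≡⟨ Listₚ.length-removeAt′ ys (Any.index x∈ys) ⟨
    length ys                ∎
    where
    open ℕₚ.≤-Reasoning
    xs⊆ys─x : All (_∈ₛ ys ─ x∈ys) xs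
    xs⊆ys─x = All.zipWith (λ (x≉y , y∈ys) → ∈-─ ys x∈ys y∈ys (x≉y ∘ ≈ₛ-sym)) (x≉xs , xs⊆ys)

length-cartesianProductWith : {A B C : Set} (f : A → B → C) (xs : List A) (ys : List B) →
                              length (List.cartesianProductWith f xs ys) ≡ length xs * length ys
length-cartesianProductWith f []       ys = refl
length-cartesianProductWith f (x ∷ xs) ys = begin
  length (map (f x) ys ++ List.cartesianProductWith f xs ys) ≡⟨ Listₚ.length-++ (map (f x) ys) ⟩
  length (map (f x) ys) + length (List.cartesianProductWith f xs ys)
    ≡⟨ cong₂ _+_ (Listₚ.length-map (f x) ys) (length-cartesianProductWith f xs ys) ⟩
  length ys + length xs * length ys ∎
  where open ≡-Reasoning

module _ {n : ℕ} where

  insert-cong : ∀ {j j′ : Fin (suc n)} {a b : Perm n} → j ≡ j′ → a ≈ b → insert zero j a ≈ insert zero j′ b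
  insert-cong refl a≈b zero    = refl
  insert-cong {j} refl a≈b (suc k) = cong (punchIn j) (a≈b k)

  insert-injective : ∀ {j j′ : Fin (suc n)} {a b : Perm n} →
                     insert zero j a ≈ insert zero j′ b → j ≡ j′ × a ≈ b
  insert-injective {j} {j′} {a} {b} eq = eq zero , λ k →
    Finₚ.punchIn-injective j _ _ (trans (eq (suc k)) (cong (λ j″ → punchIn j″ (b ⟨$⟩ʳ k)) (sym (eq zero))))

allPerms : ∀ n → List (Perm n)
allPerms zero    = idₚ ∷ []
allPerms (suc n) = List.cartesianProductWith (insert zero) (allFin (suc n)) (allPerms n)

length-allPerms : ∀ n → length (allPerms n) ≡ n !
length-allPerms zero    = refl
length-allPerms (suc n) = trans (length-cartesianProductWith (insert zero) (allFin (suc n)) (allPerms n))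
  (cong₂ _*_ (Listₚ.length-tabulate {n = suc n} (λ i → i)) (length-allPerms n))

∈-allPerms : ∀ n (π : Perm n) → π ∈ₚ allPerms n
∈-allPerms zero    π = here (λ ())
∈-allPerms (suc n) π = ∈ₚ-resp-≈ {p = insert zero (π ⟨$⟩ʳ zero) (remove zero π)} {q = π} (insert-remove zero π)
  (SetoidMembershipₚ.∈-cartesianProductWith⁺ (setoid (Fin (suc n))) (≈-setoid n) (≈-setoid (suc n))
    insert-cong (∈-allFin (π ⟨$⟩ʳ zero)) (∈-allPerms n (remove zero π)))

allPerms-distinct : ∀ n → Distinct (allPerms n)
allPerms-distinct zero    = [] ∷ []
allPerms-distinct (suc n) =
  SetoidUniqueₚ.cartesianProductWith⁺ (setoid (Fin (suc n))) (≈-setoid n) (≈-setoid (suc n))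
    (insert zero) insert-injective (allFin⁺ (suc n)) (allPerms-distinct n)

module _ {n : ℕ} where

  distinct⇒length≤! : {xs : List (Perm n)} → Distinct xs → length xs ≤ n !
  distinct⇒length≤! {xs} xs! = subst (length xs ≤_) (length-allPerms n)
    (Unique-⊆⇒length≤ (≈-setoid n) xs! (All.tabulate (λ {x} _ → ∈-allPerms n x)))

  complete⇒!≤length : {xs : List (Perm n)} → (∀ x → x ∈ₚ xs) → n ! ≤ length xs
  complete⇒!≤length {xs} complete = subst (_≤ length xs) (length-allPerms n)
    (Unique-⊆⇒length≤ (≈-setoid n) (allPerms-distinct n) (All.tabulate (λ {x} _ → complete x)))

  distinct∧!≤length⇒complete : {xs : List (Perm n)} → Distinct xs → n ! ≤ length xs → ∀ x → x ∈ₚ xs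
  distinct∧!≤length⇒complete {xs} xs! n!≤ x with x ∈ₚ? xs
  ... | yes x∈xs = x∈xs
  ... | no  x∉xs = ⊥-elim (ℕₚ.<-irrefl refl
        (ℕₚ.≤-trans (distinct⇒length≤! {x ∷ xs} (Allₚ.¬Any⇒All¬ xs x∉xs ∷ xs!)) n!≤))

module _ {n : ℕ} where

  length-++-map : (S : List (Perm n)) (f : Perm n → Perm n) → length (S ++ map f S) ≡ 2 * length S
  length-++-map S f = begin
    length (S ++ map f S)          ≡⟨ Listₚ.length-++ S ⟩
    length S + length (map f S)    ≡⟨ cong (length S +_) (Listₚ.length-map f S) ⟩
    length S + length S            ≡⟨ cong (length S +_) (ℕₚ.+-identityʳ (length S)) ⟨
    2 * length S                   ∎
    where open ≡-Reasoning

  ∈⇒∈ₚ : {a : Perm n} {S : List (Perm n)} → a ∈ S → a ∈ₚ S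
  ∈⇒∈ₚ = Any.map λ { refl _ → refl }

  ++-translate-distinct : {S : List (Perm n)} (f : Perm n) → Distinct S →
                          (∀ a b → a ∈ₚ S → b ∈ₚ S → ¬ a ≈ f · b) → Distinct (S ++ map (f ·_) S)
  ++-translate-distinct f S! apart = AllPairsₚ.++⁺ S!
    (AllPairsₚ.map⁺ (AllPairs.map (λ {a} {b} a≉b fa≈fb → a≉b λ i → ⟨$⟩ʳ-injective f (fa≈fb i)) S!))
    (All.tabulate λ {a} a∈S → Allₚ.map⁺ (All.tabulate λ {b} b∈S → apart a b (∈⇒∈ₚ a∈S) (∈⇒∈ₚ b∈S)))

  involution-halves : {S : List (Perm n)} (t : Perm n) → t · t ≈ idₚ → Distinct S →
                      (∀ x → (t · x) ∈ₚ S ⇔ (¬ x ∈ₚ S)) → 2 * length S ≡ n !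
  involution-halves {S} t t·t≈id S! t-swaps = trans (sym (length-++-map S (t ·_)))
    (ℕₚ.≤-antisym (distinct⇒length≤! (++-translate-distinct t S! apart)) (complete⇒!≤length covers))
    where
    apart : ∀ a b → a ∈ₚ S → b ∈ₚ S → ¬ a ≈ t · b
    apart a b a∈S b∈S a≈tb = Equivalence.to (t-swaps a)
      (∈ₚ-resp-≈ {p = b} {q = t · a} (λ i → trans (sym (t·t≈id (b ⟨$⟩ʳ i))) (cong (t ⟨$⟩ʳ_) (sym (a≈tb i)))) b∈S)
      a∈S
    covers : ∀ x → x ∈ₚ (S ++ map (t ·_) S)
    covers x with x ∈ₚ? S
    ... | yes x∈S = Anyₚ.++⁺ˡ x∈S
    ... | no  x∉S = Anyₚ.++⁺ʳ S (Anyₚ.map⁺ (Any.map (λ {y} → x≈t·y {y}) (Equivalence.from (t-swaps x) x∉S)))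
      where
      x≈t·y : ∀ {y} → t · x ≈ y → x ≈ t · y
      x≈t·y tx≈y i = trans (sym (t·t≈id (x ⟨$⟩ʳ i))) (cong (t ⟨$⟩ʳ_) (tx≈y i))

-- Inversions and adjacent transpositions

module _ {a p q} {A : Set a} {P : Pred A p} {Q : Pred A q} (P? : Decidable P) (Q? : Decidable Q) where
  open Equivalence

  length-filter-cong : (xs : List A) → All (λ x → P x ⇔ Q x) xs → length (filter P? xs) ≡ length (filter Q? xs)
  length-filter-cong []       []              = refl
  length-filter-cong (x ∷ xs) (Px⇔Qx ∷ P⇔Q) with P? x | Q? x
  ... | yes _  | yes _  = cong suc (length-filter-cong xs P⇔Q)
  ... | yes Px | no ¬Qx = ⊥-elim (¬Qx (to Px⇔Qx Px))
  ... | no ¬Px | yes Qx = ⊥-elim (¬Px (from Px⇔Qx Qx))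
  ... | no _   | no _   = length-filter-cong xs P⇔Q

  length-filter-suc : {xs : List A} {z : A} → Unique xs → z ∈ xs → ¬ P z → Q z →
                      (∀ x → x ≢ z → P x ⇔ Q x) → length (filter Q? xs) ≡ suc (length (filter P? xs))
  length-filter-suc {x ∷ xs} (z∉xs ∷ _) (here refl) ¬Pz Qz P⇔Q with P? x | Q? x
  ... | yes Pz | _      = ⊥-elim (¬Pz Pz)
  ... | no _   | no ¬Qz = ⊥-elim (¬Qz Qz)
  ... | no _   | yes _  = cong suc (sym (length-filter-cong xs (All.map (λ {y} z≢y → P⇔Q y (z≢y ∘ sym)) z∉xs)))
  length-filter-suc {x ∷ xs} (x∉xs ∷ xs!) (there z∈xs) ¬Pz Qz P⇔Q with P⇔Q x (All.lookup x∉xs z∈xs) | P? x | Q? x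
  ... | _     | yes _  | yes _  = cong suc (length-filter-suc xs! z∈xs ¬Pz Qz P⇔Q)
  ... | Px⇔Qx | yes Px | no ¬Qx = ⊥-elim (¬Qx (to Px⇔Qx Px))
  ... | Px⇔Qx | no ¬Px | yes Qx = ⊥-elim (¬Px (from Px⇔Qx Qx))
  ... | _     | no _   | no _   = length-filter-suc xs! z∈xs ¬Pz Qz P⇔Q

module _ {n : ℕ} where

  IsInversion : Perm n → Pred (Fin n × Fin n) 0ℓ
  IsInversion π (i , j) = i <ᶠ j × π ⟨$⟩ʳ j <ᶠ π ⟨$⟩ʳ i

  isInversion? : (π : Perm n) → Decidable (IsInversion π)
  isInversion? π (i , j) = (i <ᶠ? j) ×-dec (π ⟨$⟩ʳ j <ᶠ? π ⟨$⟩ʳ i)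

  positionPairs : List (Fin n × Fin n)
  positionPairs = cartesianProduct (allFin n) (allFin n)

  inversions-resp-≈ : {a b : Perm n} → a ≈ b → inversions a ≡ inversions b
  inversions-resp-≈ {a} {b} a≈b = length-filter-cong (isInversion? a) (isInversion? b) positionPairs
    (All.tabulate λ {(i , j)} _ → mk⇔ (λ (i<j , lt) → i<j , subst₂ _<ᶠ_ (a≈b j) (a≈b i) lt)
                                       (λ (i<j , lt) → i<j , subst₂ _<ᶠ_ (sym (a≈b j)) (sym (a≈b i)) lt))

  ≈id⇒inversions≡0 : {a : Perm n} → a ≈ idₚ → inversions a ≡ 0
  ≈id⇒inversions≡0 {a} a≈id = trans (inversions-resp-≈ {a = a} {b = idₚ} a≈id)
    (cong length (Listₚ.filter-none (isInversion? idₚ) {xs = positionPairs}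
      (All.tabulate λ _ (i<j , j<i) → Finₚ.<-asym i<j j<i)))

<⇔<-suc : {x y : ℕ} → x ≢ y → x < y ⇔ x < suc y
<⇔<-suc x≢y = mk⇔ ℕₚ.m<n⇒m<1+n (λ x<1+y → ℕₚ.≤∧≢⇒< (ℕₚ.≤-pred x<1+y) x≢y)

<⇔suc-< : {x y : ℕ} → x ≢ suc y → y < x ⇔ suc y < x
<⇔suc-< x≢1+y = mk⇔ (λ y<x → ℕₚ.≤∧≢⇒< y<x (x≢1+y ∘ sym)) (ℕₚ.<-trans (ℕₚ.n<1+n _))

module Adjacent {m : ℕ} (k : Fin m) where

  u v : Fin (suc m)
  u = inject₁ k
  v = suc k

  swap : Perm (suc m)
  swap = transpose u v

  -- the value k + 1 stands to the left of the value k in π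
  Descent : Perm (suc m) → Set
  Descent π = π ⟨$⟩ˡ v <ᶠ π ⟨$⟩ˡ u

  toℕ-v : toℕ v ≡ suc (toℕ u)
  toℕ-v = cong suc (sym (Finₚ.toℕ-inject₁ k))

  u<v : u <ᶠ v
  u<v = subst (toℕ u <_) (sym toℕ-v) (ℕₚ.n<1+n _)

  data View (x : Fin (suc m)) : Set where
    at-u  : x ≡ u → View x
    at-v  : x ≡ v → View x
    apart : x ≢ u → x ≢ v → View x

  view : (x : Fin (suc m)) → View x
  view x with x Finₚ.≟ u | x Finₚ.≟ v
  ... | yes x≡u | _       = at-u x≡u
  ... | no _    | yes x≡v = at-v x≡v
  ... | no x≢u  | no x≢v  = apart x≢u x≢v

  below-u⇔below-v : {b : Fin (suc m)} → b ≢ u → b <ᶠ u ⇔ b <ᶠ v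
  below-u⇔below-v {b} b≢u =
    subst (λ w → toℕ b < toℕ u ⇔ toℕ b < w) (sym toℕ-v) (<⇔<-suc (b≢u ∘ Finₚ.toℕ-injective))

  above-u⇔above-v : {a : Fin (suc m)} → a ≢ v → u <ᶠ a ⇔ v <ᶠ a
  above-u⇔above-v {a} a≢v = subst (λ w → toℕ u < toℕ a ⇔ w < toℕ a) (sym toℕ-v)
    (<⇔suc-< λ eq → a≢v (Finₚ.toℕ-injective (trans eq (sym toℕ-v))))

  swap-preserves-< : ∀ a b → ¬ (a ≡ u × b ≡ v) → ¬ (a ≡ v × b ≡ u) →
                     b <ᶠ a ⇔ PC.transpose u v b <ᶠ PC.transpose u v a
  swap-preserves-< a b ¬uv ¬vu with view a | view b
  ... | at-u refl | at-v refl = ⊥-elim (¬uv (refl , refl))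
  ... | at-v refl | at-u refl = ⊥-elim (¬vu (refl , refl))
  ... | at-u refl | at-u refl = mk⇔ (⊥-elim ∘ Finₚ.<-irrefl refl) (⊥-elim ∘ Finₚ.<-irrefl refl)
  ... | at-v refl | at-v refl = mk⇔ (⊥-elim ∘ Finₚ.<-irrefl refl) (⊥-elim ∘ Finₚ.<-irrefl refl)
  ... | at-u refl | apart b≢u b≢v
    rewrite transpose-matchˡ u v | transpose-other b≢u b≢v = below-u⇔below-v b≢u
  ... | at-v refl | apart b≢u b≢v
    rewrite transpose-matchʳ u v | transpose-other b≢u b≢v = ⇔-sym (below-u⇔below-v b≢u)
  ... | apart a≢u a≢v | at-u refl
    rewrite transpose-matchˡ u v | transpose-other a≢u a≢v = above-u⇔above-v a≢v
  ... | apart a≢u a≢v | at-v refl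
    rewrite transpose-matchʳ u v | transpose-other a≢u a≢v = ⇔-sym (above-u⇔above-v a≢v)
  ... | apart a≢u a≢v | apart b≢u b≢v
    rewrite transpose-other a≢u a≢v | transpose-other b≢u b≢v = mk⇔ (λ lt → lt) (λ lt → lt)

  swap-swap : (π : Perm (suc m)) → swap · (swap · π) ≈ π
  swap-swap π i = transpose-involutive u v (π ⟨$⟩ʳ i)

  inversions-descent : (π : Perm (suc m)) → Descent π → inversions π ≡ suc (inversions (swap · π))
  inversions-descent π descent =
    length-filter-suc (isInversion? (swap · π)) (isInversion? π)
      (cartesianProduct⁺ (allFin⁺ _) (allFin⁺ _)) (∈-cartesianProduct⁺ (∈-allFin p) (∈-allFin q))
      swapped-not-inversion inversion agree-elsewhere
    where
    p q : Fin (suc m)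
    p = π ⟨$⟩ˡ v
    q = π ⟨$⟩ˡ u
    πp : π ⟨$⟩ʳ p ≡ v
    πp = inverseʳ π
    πq : π ⟨$⟩ʳ q ≡ u
    πq = inverseʳ π
    inversion : IsInversion π (p , q)
    inversion rewrite πp | πq = descent , u<v
    swapped-not-inversion : ¬ IsInversion (swap · π) (p , q)
    swapped-not-inversion (_ , v<u) rewrite πp | πq | transpose-matchˡ u v | transpose-matchʳ u v =
      Finₚ.<-asym v<u u<v
    agree-elsewhere : ∀ ij → ij ≢ (p , q) → IsInversion (swap · π) ij ⇔ IsInversion π ij
    agree-elsewhere (i , j) ij≢pq = mk⇔
      (λ (i<j , lt) → i<j , Equivalence.from (order i<j) lt)
      (λ (i<j , lt) → i<j , Equivalence.to (order i<j) lt)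
      where
      order : i <ᶠ j → π ⟨$⟩ʳ j <ᶠ π ⟨$⟩ʳ i ⇔ (swap · π) ⟨$⟩ʳ j <ᶠ (swap · π) ⟨$⟩ʳ i
      order i<j = swap-preserves-< (π ⟨$⟩ʳ i) (π ⟨$⟩ʳ j)
        (λ (πi≡u , πj≡v) → Finₚ.<-asym descent
          (subst₂ _<ᶠ_ (⟨$⟩ʳ-injective π (trans πi≡u (sym πq))) (⟨$⟩ʳ-injective π (trans πj≡v (sym πp))) i<j))
        (λ (πi≡v , πj≡u) → ij≢pq (cong₂ _,_ (⟨$⟩ʳ-injective π (trans πi≡v (sym πp)))
                                            (⟨$⟩ʳ-injective π (trans πj≡u (sym πq)))))

  inversions-swap : (π : Perm (suc m)) →
                    inversions π ≡ suc (inversions (swap · π)) ⊎ inversions (swap · π) ≡ suc (inversions π)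
  inversions-swap π with π ⟨$⟩ˡ v <ᶠ? π ⟨$⟩ˡ u
  ... | yes descent = inj₁ (inversions-descent π descent)
  ... | no ¬descent = inj₂ (trans (inversions-descent (swap · π) swapped-descent)
                                  (cong suc (inversions-resp-≈ {a = swap · (swap · π)} {b = π} (swap-swap π))))
    where
    swapped-descent : Descent (swap · π)
    swapped-descent rewrite transpose-matchˡ v u | transpose-matchʳ v u =
      ℕₚ.≤∧≢⇒< (ℕₚ.≮⇒≥ ¬descent) λ eq → Finₚ.<-irrefl (⟨$⟩ʳ-injective (flip π) (Finₚ.toℕ-injective eq)) u<v

%2-suc : ∀ m → suc m % 2 ≡ 1 ∸ m % 2
%2-suc zero          = refl
%2-suc (suc zero)    = refl
%2-suc (suc (suc m)) = %2-suc m

1∸1∸%2 : ∀ m → 1 ∸ (1 ∸ m % 2) ≡ m % 2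
1∸1∸%2 zero          = refl
1∸1∸%2 (suc zero)    = refl
1∸1∸%2 (suc (suc m)) = 1∸1∸%2 m

0≢1 : 0 ≢ 1
0≢1 ()

%2-dichotomy : ∀ m → m % 2 ≡ 0 ⊎ m % 2 ≡ 1
%2-dichotomy zero          = inj₁ refl
%2-dichotomy (suc zero)    = inj₂ refl
%2-dichotomy (suc (suc m)) = %2-dichotomy m

module _ {m : ℕ} (k : Fin m) where
  open Adjacent k

  swap-flips-parity : (π : Perm (suc m)) → inversions (swap · π) % 2 ≡ 1 ∸ inversions π % 2
  swap-flips-parity π with inversions-swap π
  ... | inj₂ eq = trans (cong (_% 2) eq) (%2-suc (inversions π))
  ... | inj₁ eq = begin
    inversions (swap · π) % 2              ≡⟨ 1∸1∸%2 (inversions (swap · π)) ⟨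
    1 ∸ (1 ∸ inversions (swap · π) % 2)    ≡⟨ cong (1 ∸_) (%2-suc (inversions (swap · π))) ⟨
    1 ∸ suc (inversions (swap · π)) % 2    ≡⟨ cong (λ w → 1 ∸ w % 2) eq ⟨
    1 ∸ inversions π % 2                   ∎
    where open ≡-Reasoning

  swap-even⇒odd : (π : Perm (suc m)) → IsEven π → IsOdd (swap · π)
  swap-even⇒odd π even = trans (swap-flips-parity π) (cong (1 ∸_) even)

  swap-odd⇒even : (π : Perm (suc m)) → IsOdd π → IsEven (swap · π)
  swap-odd⇒even π odd = trans (swap-flips-parity π) (cong (1 ∸_) odd)

  swap-even⇔¬even : (π : Perm (suc m)) → IsEven (swap · π) ⇔ (¬ IsEven π)
  swap-even⇔¬even π = mk⇔ (λ even-sπ even-π → 0≢1 (trans (sym even-sπ) (swap-even⇒odd π even-π)))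
    λ ¬even → [ (λ even → ⊥-elim (¬even even)) , swap-odd⇒even π ]′ (%2-dichotomy (inversions π))

  swap-odd⇔¬odd : (π : Perm (suc m)) → IsOdd (swap · π) ⇔ (¬ IsOdd π)
  swap-odd⇔¬odd π = mk⇔ (λ odd-sπ odd-π → 0≢1 (trans (sym (swap-odd⇒even π odd-π)) odd-sπ))
    λ ¬odd → [ swap-even⇒odd π , (λ odd → ⊥-elim (¬odd odd)) ]′ (%2-dichotomy (inversions π))

  odd⇔swap·even : (π : Perm (suc m)) → IsOdd π ⇔ (∃ λ a → IsEven a × π ≈ swap · a)
  odd⇔swap·even π = mk⇔
    (λ odd → swap · π , swap-odd⇒even π odd , λ i → sym (swap-swap π i))
    (λ (a , even , π≈sa) →
      trans (cong (_% 2) (inversions-resp-≈ {a = π} {b = swap · a} π≈sa)) (swap-even⇒odd a even))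

increasing⇒≡id : {m : ℕ} (f : Fin (suc m) → Fin (suc m)) → (∀ k → f (inject₁ k) <ᶠ f (suc k)) → ∀ i → f i ≡ i
increasing⇒≡id {m} f increasing i = Finₚ.toℕ-injective (ℕₚ.≤-antisym (shrinks i) (grows i))
  where
  grows : ∀ i → toℕ i ≤ toℕ (f i)
  grows = <-weakInduction (λ i → toℕ i ≤ toℕ (f i)) z≤n λ k ih →
    ℕₚ.≤-<-trans (subst (_≤ toℕ (f (inject₁ k))) (Finₚ.toℕ-inject₁ k) ih) (increasing k)
  shrinks : ∀ i → toℕ (f i) ≤ toℕ i
  shrinks = >-weakInduction (λ i → toℕ (f i) ≤ toℕ i)
    (subst (toℕ (f (fromℕ m)) ≤_) (sym (Finₚ.toℕ-fromℕ m)) (Finₚ.toℕ≤pred[n] (f (fromℕ m)))) λ k ih →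
    subst (toℕ (f (inject₁ k)) ≤_) (sym (Finₚ.toℕ-inject₁ k)) (ℕₚ.≤-pred (ℕₚ.<-≤-trans (increasing k) ih))

descent-or-≈id : {m : ℕ} (π : Perm (suc m)) → (∃ λ k → Adjacent.Descent k π) ⊎ π ≈ idₚ
descent-or-≈id π with Finₚ.any? (λ k → π ⟨$⟩ˡ Adjacent.v k <ᶠ? π ⟨$⟩ˡ Adjacent.u k)
... | yes descent = inj₁ descent
... | no ¬descent = inj₂ λ i →
  trans (cong (π ⟨$⟩ʳ_) (sym (increasing⇒≡id (flip π ⟨$⟩ʳ_) increasing i))) (inverseʳ π)
  where
  increasing : ∀ k → π ⟨$⟩ˡ inject₁ k <ᶠ π ⟨$⟩ˡ suc k
  increasing k = ℕₚ.≤∧≢⇒< (ℕₚ.≮⇒≥ (¬descent ∘ (k ,_)))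
    λ eq → Finₚ.<-irrefl (⟨$⟩ʳ-injective (flip π) (Finₚ.toℕ-injective eq)) (Adjacent.u<v k)

-- Subsets flipped or stabilised by a conjugacy class

module ⇔-Reasoning = SetoidReasoning (⇔-setoid 0ℓ)

¬¬-⇔ : {A : Set} → Dec A → (¬ ¬ A) ⇔ A
¬¬-⇔ A? = mk⇔ (decidable-stable A?) (λ a ¬a → ¬a a)

infixr 8 _^_
_^_ : {n : ℕ} → Perm n → ℕ → Perm n
t ^ zero  = idₚ
t ^ suc k = t · t ^ k

involution-^-%2 : {n : ℕ} {t : Perm n} → t · t ≈ idₚ → ∀ k → t ^ k ≈ t ^ (k % 2)
involution-^-%2 t·t≈id zero          = λ _ → refl
involution-^-%2 t·t≈id (suc zero)    = λ _ → refl
involution-^-%2 {t = t} t·t≈id (suc (suc k)) i =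
  trans (t·t≈id (t ^ k ⟨$⟩ʳ i)) (involution-^-%2 t·t≈id k i)

-- Flips and Stabilises quantify over all conjugates σ e σ⁻¹, so both are closed under conjugation.
module LeftTranslation {n : ℕ} (P : Pred (Perm n) 0ℓ) (P? : Decidable P)
                       (P-resp-≈ : ∀ {a b} → a ≈ b → P a → P b) where

  P-cong : {a b : Perm n} → a ≈ b → P a ⇔ P b
  P-cong a≈b = mk⇔ (P-resp-≈ a≈b) (P-resp-≈ (λ i → sym (a≈b i)))

  record Flips (e : Perm n) : Set where
    constructor flipping
    field flips : ∀ σ x → P (conj σ e · x) ⇔ (¬ P x)

  record Stabilises (h : Perm n) : Set where
    constructor stabilising
    field stabilises : ∀ σ x → P (conj σ h · x) ⇔ P x

  Flips-conj : ∀ {e} τ → Flips e → Flips (conj τ e)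
  Flips-conj τ (flipping f) = flipping λ σ → f (σ · τ)

  Stabilises-conj : ∀ {h} τ → Stabilises h → Stabilises (conj τ h)
  Stabilises-conj τ (stabilising s) = stabilising λ σ → s (σ · τ)

  Stabilises-resp-≈ : ∀ {h h′} → h ≈ h′ → Stabilises h → Stabilises h′
  Stabilises-resp-≈ h≈h′ (stabilising s) =
    stabilising λ σ x → s σ x ⇔-∘ P-cong (λ i → cong (σ ⟨$⟩ʳ_) (sym (h≈h′ _)))

  Flips-· : ∀ {e₁ e₂} → Flips e₁ → Flips e₂ → Stabilises (e₁ · e₂)
  Flips-· {e₁} {e₂} (flipping f₁) (flipping f₂) = stabilising λ σ x → begin
    P (conj σ (e₁ · e₂) · x)            ≈⟨ P-cong (λ i → sym (conj-· σ e₁ e₂ (x ⟨$⟩ʳ i))) ⟩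
    P (conj σ e₁ · (conj σ e₂ · x))     ≈⟨ f₁ σ (conj σ e₂ · x) ⟩
    (¬ P (conj σ e₂ · x))               ≈⟨ ¬-cong-⇔ (f₂ σ x) ⟩
    (¬ ¬ P x)                           ≈⟨ ¬¬-⇔ (P? x) ⟩
    P x                                 ∎
    where open ⇔-Reasoning

  Flips-·-Stabilises : ∀ {e h} → Flips e → Stabilises h → Flips (e · h)
  Flips-·-Stabilises {e} {h} (flipping f) (stabilising s) = flipping λ σ x → begin
    P (conj σ (e · h) · x)              ≈⟨ P-cong (λ i → sym (conj-· σ e h (x ⟨$⟩ʳ i))) ⟩
    P (conj σ e · (conj σ h · x))       ≈⟨ f σ (conj σ h · x) ⟩
    (¬ P (conj σ h · x))                ≈⟨ ¬-cong-⇔ (s σ x) ⟩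
    (¬ P x)                             ∎
    where open ⇔-Reasoning

  Flips-⁻¹ : ∀ {e} → Flips e → Flips (e ⁻¹)
  Flips-⁻¹ {e} (flipping f) = flipping λ σ x → let y = conj σ (e ⁻¹) · x in begin
    P y                                 ≈⟨ ¬¬-⇔ (P? y) ⟨
    (¬ ¬ P y)                           ≈⟨ ¬-cong-⇔ (f σ y) ⟨
    (¬ P (conj σ e · y))                ≈⟨ ¬-cong-⇔ (P-cong (cancel σ x)) ⟩
    (¬ P x)                             ∎
    where
    open ⇔-Reasoning
    cancel : ∀ σ x → conj σ e · (conj σ (e ⁻¹) · x) ≈ x
    cancel σ x i = trans (cong (λ j → σ ⟨$⟩ʳ (e ⟨$⟩ʳ j)) (inverseˡ σ))
                         (trans (cong (σ ⟨$⟩ʳ_) (inverseʳ e)) (inverseʳ σ))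

  Flips⇒≉id : ∀ {e} → Flips e → ¬ e ≈ idₚ
  Flips⇒≉id (flipping f) e≈id = ¬p p
    where
    P⇔¬P : P idₚ ⇔ (¬ P idₚ)
    P⇔¬P = f idₚ idₚ ⇔-∘ P-cong (λ i → sym (e≈id i))
    ¬p : ¬ P idₚ
    ¬p p = Equivalence.to P⇔¬P p p
    p : P idₚ
    p = Equivalence.from P⇔¬P ¬p

  Stabilises-drop : ∀ {h} → Stabilises h → ∀ z w → P (z · h · w) ⇔ P (z · w)
  Stabilises-drop {h} (stabilising s) z w = s z (z · w) ⇔-∘ P-cong (λ i → sym (conj-·-right z h w i))

  Flips⇒Stabilises-transposes : ∀ {e} → Flips e → ∀ u v →
                                Stabilises (transpose u v · transpose (e ⟨$⟩ʳ u) (e ⟨$⟩ʳ v))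
  Flips⇒Stabilises-transposes {e} flips u v =
    Stabilises-resp-≈ commutator (Flips-· (Flips-conj (transpose u v) flips) (Flips-⁻¹ flips))
    where
    commutator : conj (transpose u v) e · e ⁻¹ ≈ transpose u v · transpose (e ⟨$⟩ʳ u) (e ⟨$⟩ʳ v)
    commutator i = cong (PC.transpose u v)
      (trans (cong (e ⟨$⟩ʳ_) (transpose-comm v u (e ⟨$⟩ˡ i))) (conj-transpose e u v i))

  Stabilises-threeCycle-transfer : ∀ {a b c a′ b′ c′} → Distinct₃ a b c → Distinct₃ a′ b′ c′ →
                                   Stabilises (threeCycle a b c) → Stabilises (threeCycle a′ b′ c′)
  Stabilises-threeCycle-transfer {a} {b} {c} abc a′b′c′ stabilises with 3-transitive abc a′b′c′
  ... | π , refl , refl , refl = Stabilises-resp-≈ (conj-threeCycle π a b c) (Stabilises-conj π stabilises)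

  StabilisedThreeCycle : Set
  StabilisedThreeCycle = ∃ λ a → ∃ λ b → ∃ λ c → Distinct₃ a b c × Stabilises (threeCycle a b c)

  module _ {e : Perm n} (flips : Flips e) where

    moved-point : ∃ λ w → e ⟨$⟩ʳ w ≢ w
    moved-point = Finₚ.¬∀⟶∃¬ n _ (λ i → e ⟨$⟩ʳ i Finₚ.≟ i) (Flips⇒≉id flips)

    fixed-point⇒StabilisedThreeCycle : ∀ {f} → e ⟨$⟩ʳ f ≡ f → StabilisedThreeCycle
    fixed-point⇒StabilisedThreeCycle {f} ef≡f with moved-point
    ... | w , ew≢w = w , f , e ⟨$⟩ʳ w , (w≢f , ew≢w ∘ sym , f≢ew) , stabilises
      where
      w≢f : w ≢ f
      w≢f w≡f = ew≢w (trans (cong (e ⟨$⟩ʳ_) w≡f) (trans ef≡f (sym w≡f)))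
      f≢ew : f ≢ e ⟨$⟩ʳ w
      f≢ew f≡ew = w≢f (⟨$⟩ʳ-injective e (trans (sym f≡ew) (sym ef≡f)))
      stabilises : Stabilises (threeCycle w f (e ⟨$⟩ʳ w))
      stabilises = Stabilises-resp-≈ (λ i → cong (PC.transpose w f) (transpose-comm (e ⟨$⟩ʳ w) f i))
        (subst (λ y → Stabilises (transpose w f · transpose (e ⟨$⟩ʳ w) y)) ef≡f
          (Flips⇒Stabilises-transposes flips w f))

    long-orbit⇒StabilisedThreeCycle : ∀ {w} → e ⟨$⟩ʳ w ≢ w → e ⟨$⟩ʳ (e ⟨$⟩ʳ w) ≢ w → StabilisedThreeCycle
    long-orbit⇒StabilisedThreeCycle {w} ew≢w eew≢w =
      w , e ⟨$⟩ʳ w , e ⟨$⟩ʳ (e ⟨$⟩ʳ w) , (ew≢w ∘ sym , eew≢w ∘ sym , ew≢w ∘ sym ∘ ⟨$⟩ʳ-injective e) ,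
      Flips⇒Stabilises-transposes flips w (e ⟨$⟩ʳ w)

  -- For a fixed-point-free involution e = (u v)(d d′)⋯, the element e (u d)(v d′) (u d′)(v d)
  -- still flips P, and it fixes u.
  involution⇒StabilisedThreeCycle : ∀ {e} → Flips e → (∀ w → e ⟨$⟩ʳ w ≢ w) → (∀ w → e ⟨$⟩ʳ (e ⟨$⟩ʳ w) ≡ w) →
                                    ∀ {u d} → d ≢ u → d ≢ e ⟨$⟩ʳ u → StabilisedThreeCycle
  involution⇒StabilisedThreeCycle {e} flips moves involutive {u} {d} d≢u d≢v =
    fixed-point⇒StabilisedThreeCycle (Flips-·-Stabilises (Flips-·-Stabilises flips h₁) h₂) e′u≡u
    where
    v d′ : Fin n
    v  = e ⟨$⟩ʳ u
    d′ = e ⟨$⟩ʳ d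
    h₁ = Flips⇒Stabilises-transposes flips u d
    h₂ = Flips⇒Stabilises-transposes flips u d′
    h₂u≡d′ : PC.transpose u d′ (PC.transpose v (e ⟨$⟩ʳ d′) u) ≡ d′
    h₂u≡d′ = trans (cong (PC.transpose u d′)
                     (transpose-other (moves u ∘ sym) (d≢u ∘ trans (sym (involutive d)) ∘ sym)))
                   (transpose-matchˡ u d′)
    h₁d′≡v : PC.transpose u d (PC.transpose v d′ d′) ≡ v
    h₁d′≡v = trans (cong (PC.transpose u d) (transpose-matchʳ v d′)) (transpose-other (moves u) (d≢v ∘ sym))
    e′u≡u : e ⟨$⟩ʳ (PC.transpose u d (PC.transpose v d′ (PC.transpose u d′ (PC.transpose v (e ⟨$⟩ʳ d′) u)))) ≡ u
    e′u≡u = trans (cong (λ x → e ⟨$⟩ʳ (PC.transpose u d (PC.transpose v d′ x))) h₂u≡d′)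
                  (trans (cong (e ⟨$⟩ʳ_) h₁d′≡v) (involutive u))

  Flips⇒StabilisedThreeCycle : ∀ {e a b c} → Flips e → Distinct₃ a b c → StabilisedThreeCycle
  Flips⇒StabilisedThreeCycle {e} {a} flips abc
    with Finₚ.any? (λ f → e ⟨$⟩ʳ f Finₚ.≟ f)
  ... | yes (f , ef≡f) = fixed-point⇒StabilisedThreeCycle flips ef≡f
  ... | no ¬fixed with Finₚ.any? (λ w → ¬? (e ⟨$⟩ʳ (e ⟨$⟩ʳ w) Finₚ.≟ w))
  ...   | yes (w , eew≢w) = long-orbit⇒StabilisedThreeCycle flips (¬fixed ∘ (w ,_)) eew≢w
  ...   | no ¬long with avoid-two abc (e ⟨$⟩ʳ a)
  ...     | d , d≢a , d≢ea = involution⇒StabilisedThreeCycle flips moves involutive d≢a d≢ea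
    where
    moves : ∀ w → e ⟨$⟩ʳ w ≢ w
    moves w = ¬fixed ∘ (w ,_)
    involutive : ∀ w → e ⟨$⟩ʳ (e ⟨$⟩ʳ w) ≡ w
    involutive w = decidable-stable (e ⟨$⟩ʳ (e ⟨$⟩ʳ w) Finₚ.≟ w) (¬long ∘ (w ,_))

  Flips⇒Stabilises-threeCycle : ∀ {e a b c} → Flips e → Distinct₃ a b c → Stabilises (threeCycle a b c)
  Flips⇒Stabilises-threeCycle flips abc with Flips⇒StabilisedThreeCycle flips abc
  ... | _ , _ , _ , a₀b₀c₀ , stabilises = Stabilises-threeCycle-transfer a₀b₀c₀ abc stabilises

module ParityClassification {m : ℕ} (P : Pred (Perm (suc (suc m))) 0ℓ) (P? : Decidable P)
                            (P-resp-≈ : ∀ {a b} → a ≈ b → P a → P b) where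
  open LeftTranslation P P? P-resp-≈
  open Adjacent using (swap)
  open ⇔-Reasoning

  t : Perm (suc (suc m))
  t = swap zero

  adjacent-distinct₃ : (j : Fin m) → Distinct₃ (inject₁ (inject₁ j)) (suc (inject₁ j)) (suc (suc j))
  adjacent-distinct₃ j = Finₚ.<⇒≢ ab , Finₚ.<⇒≢ (Finₚ.<-trans ab bc) , Finₚ.<⇒≢ bc
    where
    ab = Adjacent.u<v (inject₁ j)
    bc = Adjacent.u<v (suc j)

  -- Since (k k+1)(k+1 k+2) stabilises P, all adjacent transpositions act on P in the same way.
  Flips⇒swap∼t : ∀ {e} → Flips e → ∀ k z w → P (z · swap k · w) ⇔ P (z · t · w)
  Flips⇒swap∼t flips = <-weakInduction (λ k → ∀ z w → P (z · swap k · w) ⇔ P (z · t · w))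
    (λ z w → ⇔-id _) step
    where
    step : ∀ j → (∀ z w → P (z · swap (inject₁ j) · w) ⇔ P (z · t · w)) →
           ∀ z w → P (z · swap (suc j) · w) ⇔ P (z · t · w)
    step j ih z w = begin
      P (z · swap (suc j) · w)                            ≈⟨ Stabilises-drop stabilises z (swap (suc j) · w) ⟨
      P (z · (swap (inject₁ j) · swap (suc j)) · (swap (suc j) · w))
        ≈⟨ P-cong (λ i → cong (λ x → z ⟨$⟩ʳ (swap (inject₁ j) ⟨$⟩ʳ x)) (Adjacent.swap-swap (suc j) w i)) ⟩
      P (z · swap (inject₁ j) · w)                        ≈⟨ ih z w ⟩
      P (z · t · w)                                       ∎
      where
      stabilises = Flips⇒Stabilises-threeCycle flips (adjacent-distinct₃ j)

  -- Bubble sort: peel off adjacent transpositions, each of which acts on P like t.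
  Flips⇒∼t^inversions : ∀ {e} → Flips e → ∀ y z w → P (z · y · w) ⇔ P (z · t ^ inversions y · w)
  Flips⇒∼t^inversions flips y = reduce (inversions y) y refl
    where
    reduce : ∀ k y → inversions y ≡ k → ∀ z w → P (z · y · w) ⇔ P (z · t ^ k · w)
    reduce k y inv≡k z w with descent-or-≈id y | k
    ... | inj₂ y≈id | zero   = P-cong (λ i → cong (z ⟨$⟩ʳ_) (y≈id (w ⟨$⟩ʳ i)))
    ... | inj₂ y≈id | suc _  = ⊥-elim (ℕₚ.0≢1+n (trans (sym (≈id⇒inversions≡0 {a = y} y≈id)) inv≡k))
    ... | inj₁ (j , descent) | zero = ⊥-elim (ℕₚ.0≢1+n (trans (sym inv≡k) (Adjacent.inversions-descent j y descent)))
    ... | inj₁ (j , descent) | suc k = begin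
      P (z · y · w)                          ≈⟨ P-cong (λ i → cong (z ⟨$⟩ʳ_) (Adjacent.swap-swap j y (w ⟨$⟩ʳ i))) ⟨
      P (z · swap j · (swap j · y · w))      ≈⟨ Flips⇒swap∼t flips j z (swap j · y · w) ⟩
      P (z · t · (swap j · y · w))           ≈⟨ reduce k (swap j · y) inv≡k′ (z · t) w ⟩
      P (z · t ^ suc k · w)                  ∎
      where
      inv≡k′ : inversions (swap j · y) ≡ k
      inv≡k′ = ℕₚ.suc-injective (trans (sym (Adjacent.inversions-descent j y descent)) inv≡k)

  t·t≈id : t · t ≈ idₚ
  t·t≈id = transpose-·-involutive zero (suc zero)

  t^even≈id : (y : Perm (suc (suc m))) → IsEven y → t ^ inversions y ≈ idₚ
  t^even≈id y even i = trans (involution-^-%2 {t = t} t·t≈id (inversions y) i) (cong (λ k → t ^ k ⟨$⟩ʳ i) even)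

  t^odd≈t : (y : Perm (suc (suc m))) → IsOdd y → t ^ inversions y ≈ t
  t^odd≈t y odd i = trans (involution-^-%2 {t = t} t·t≈id (inversions y) i) (cong (λ k → t ^ k ⟨$⟩ʳ i) odd)

  module _ {g : Perm (suc (suc m))} (flips : Flips g) (g-odd : IsOdd g) where

    t-flips : ∀ x → P (t · x) ⇔ (¬ P x)
    t-flips x = begin
      P (t · x)                 ≈⟨ P-cong (λ i → t^odd≈t g g-odd (x ⟨$⟩ʳ i)) ⟨
      P (t ^ inversions g · x)  ≈⟨ Flips⇒∼t^inversions flips g idₚ x ⟨
      P (g · x)                 ≈⟨ Flips.flips flips idₚ x ⟩
      (¬ P x)                   ∎

    even⇒P⇔P-id : ∀ p → IsEven p → P p ⇔ P idₚ
    even⇒P⇔P-id p even = begin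
      P p                       ≈⟨ P-cong (λ _ → refl) ⟩
      P (idₚ · p · idₚ)         ≈⟨ Flips⇒∼t^inversions flips p idₚ idₚ ⟩
      P (t ^ inversions p)      ≈⟨ P-cong (t^even≈id p even) ⟩
      P idₚ                     ∎

    odd⇒P⇔¬P-id : ∀ p → IsOdd p → P p ⇔ (¬ P idₚ)
    odd⇒P⇔¬P-id p odd = begin
      P p                       ≈⟨ P-cong (λ _ → refl) ⟩
      P (idₚ · p · idₚ)         ≈⟨ Flips⇒∼t^inversions flips p idₚ idₚ ⟩
      P (t ^ inversions p)      ≈⟨ P-cong (t^odd≈t p odd) ⟩
      P (t · idₚ)               ≈⟨ t-flips idₚ ⟩
      (¬ P idₚ)                 ∎

    Flips-odd⇒Alt⊎oddCoset : (∀ p → P p ⇔ IsEven p) ⊎ (∀ p → P p ⇔ IsOdd p)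
    Flips-odd⇒Alt⊎oddCoset with P? idₚ
    ... | yes P-id = inj₁ λ p → mk⇔
      (λ Pp → [ (λ even → even) , (λ odd → ⊥-elim (Equivalence.to (odd⇒P⇔¬P-id p odd) Pp P-id)) ]′
                (%2-dichotomy (inversions p)))
      (λ even → Equivalence.from (even⇒P⇔P-id p even) P-id)
    ... | no ¬P-id = inj₂ λ p → mk⇔
      (λ Pp → [ (λ even → ⊥-elim (¬P-id (Equivalence.to (even⇒P⇔P-id p even) Pp))) , (λ odd → odd) ]′
                (%2-dichotomy (inversions p)))
      (λ odd → Equivalence.from (odd⇒P⇔¬P-id p odd) ¬P-id)

-- Independent sets

module IndependentSet {n : ℕ} (g : Perm n) (S : List (Perm n)) (S! : Distinct S)
                      (independent : Independent g S) where
  open LeftTranslation (_∈ₚ S) (_∈ₚ? S) (λ {a} {b} → ∈ₚ-resp-≈ {p = a} {q = b})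

  conjugate-apart : ∀ σ x → x ∈ₚ S → ¬ (conj σ g · x) ∈ₚ S
  conjugate-apart σ x x∈S cx∈S =
    independent (conj σ g · x) x cx∈S x∈S (σ , λ i → cong (conj σ g ⟨$⟩ʳ_) (inverseʳ x))

  disjoint-translate : ∀ σ → Distinct (S ++ map (conj σ g ⁻¹ ·_) S)
  disjoint-translate σ = ++-translate-distinct (c ⁻¹) S! λ a b a∈S b∈S a≈c⁻¹b →
    conjugate-apart σ a a∈S (∈ₚ-resp-≈ {p = b} {q = c · a} (λ i → sym (c·a≈b {a} {b} a≈c⁻¹b i)) b∈S)
    where
    c = conj σ g
    c·a≈b : ∀ {a b} → a ≈ c ⁻¹ · b → c · a ≈ b
    c·a≈b a≈c⁻¹b i = trans (cong (c ⟨$⟩ʳ_) (a≈c⁻¹b i)) (inverseʳ c)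

  double-length≤! : 2 * length S ≤ n !
  double-length≤! = subst (_≤ n !) (length-++-map S (g ⁻¹ ·_)) (distinct⇒length≤! (disjoint-translate idₚ))

  -- At equality S ⊔ c⁻¹S is all of Sym(n), so every x outside S has c x ∈ S.
  double-length≡!⇒Flips : 2 * length S ≡ n ! → Flips g
  double-length≡!⇒Flips eq = flipping λ σ x → mk⇔ (λ cx∈S x∈S → conjugate-apart σ x x∈S cx∈S) (outside σ x)
    where
    outside : ∀ σ x → ¬ x ∈ₚ S → (conj σ g · x) ∈ₚ S
    outside σ x x∉S with Anyₚ.++⁻ S (distinct∧!≤length⇒complete (disjoint-translate σ)
                                      (ℕₚ.≤-reflexive (trans (sym eq) (sym (length-++-map S _)))) x)
    ... | inj₁ x∈S     = ⊥-elim (x∉S x∈S)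
    ... | inj₂ x∈c⁻¹S = Any.map (λ x≈c⁻¹b i → trans (cong (conj σ g ⟨$⟩ʳ_) (x≈c⁻¹b i)) (inverseʳ (conj σ g)))
                                (Anyₚ.map⁻ x∈c⁻¹S)

module _ {m : ℕ} (S : List (Perm (suc (suc m)))) where
  open Adjacent (zero {m}) using (swap)

  IsAlt⇔ : IsAlt S ⇔ (∀ p → p ∈ₚ S ⇔ IsEven p)
  IsAlt⇔ = mk⇔ (λ alt p → mk⇔ (proj₁ (alt p)) (proj₂ (alt p)))
               (λ alt p → Equivalence.to (alt p) , Equivalence.from (alt p))

  IsT12Alt⇔ : IsT12Alt (s≤s (s≤s z≤n)) S ⇔ (∀ p → p ∈ₚ S ⇔ IsOdd p)
  IsT12Alt⇔ = mk⇔
    (λ coset p → mk⇔ (from (odd⇔swap·even zero p) ∘ proj₁ (coset p)) (proj₂ (coset p) ∘ to (odd⇔swap·even zero p)))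
    (λ odd p → to (odd⇔swap·even zero p) ∘ to (odd p) , from (odd p) ∘ from (odd⇔swap·even zero p))
    where open Equivalence

  parity-class-halves : Distinct S → (∀ p → p ∈ₚ S ⇔ IsEven p) ⊎ (∀ p → p ∈ₚ S ⇔ IsOdd p) →
                        2 * length S ≡ suc (suc m) !
  parity-class-halves S! class = involution-halves swap (transpose-·-involutive zero (suc zero)) S! (swaps class)
    where
    swaps : (∀ p → p ∈ₚ S ⇔ IsEven p) ⊎ (∀ p → p ∈ₚ S ⇔ IsOdd p) → ∀ x → (swap · x) ∈ₚ S ⇔ (¬ x ∈ₚ S)
    swaps (inj₁ even) x = ¬-cong-⇔ (⇔-sym (even x)) ⇔-∘ (swap-even⇔¬even zero x ⇔-∘ even (swap · x))
    swaps (inj₂ odd)  x = ¬-cong-⇔ (⇔-sym (odd x)) ⇔-∘ (swap-odd⇔¬odd zero x ⇔-∘ odd (swap · x))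

theorem7p8 : (n : ℕ) → (h2 : 2 ≤ n) → (g : Permutation′ n) →
    (∀ c → InClass g c → IsOdd c) →
    (S : List (Permutation′ n)) → Distinct S → Independent g S →
    (length S ≤ (n !) / 2) × ((length S ≡ (n !) / 2) ⇔ (IsAlt S ⊎ IsT12Alt h2 S))
theorem7p8 (suc (suc m)) (s≤s (s≤s z≤n)) g class-odd S S! independent =
  ℕₚ.*-cancelˡ-≤ 2 (subst (2 * length S ≤_) (sym 2*[n!/2]≡n!) double-length≤!) ,
  mk⇔ (λ |S|≡n!/2 → Sum.map (from (IsAlt⇔ S)) (from (IsT12Alt⇔ S))
                      (Flips-odd⇒Alt⊎oddCoset (double-length≡!⇒Flips (double |S|≡n!/2)) g-odd))
      (λ classified → ℕₚ.*-cancelˡ-≡ (length S) _ 2 (trans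
        (parity-class-halves S S! (Sum.map (to (IsAlt⇔ S)) (to (IsT12Alt⇔ S)) classified)) (sym 2*[n!/2]≡n!)))
  where
  open IndependentSet g S S! independent
  open ParityClassification (_∈ₚ S) (_∈ₚ? S) (λ {a} {b} → ∈ₚ-resp-≈ {p = a} {q = b})
  open Equivalence
  2*[n!/2]≡n! : 2 * (suc (suc m) ! / 2) ≡ suc (suc m) !
  2*[n!/2]≡n! = m*[n/m]≡n (m≤n⇒m!∣n! {2} {suc (suc m)} (s≤s (s≤s z≤n)))
  double : length S ≡ suc (suc m) ! / 2 → 2 * length S ≡ suc (suc m) !
  double |S|≡ = trans (cong (2 *_) |S|≡) 2*[n!/2]≡n!
  g-odd : IsOdd g
  g-odd = class-odd g (idₚ , λ _ → refl)
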